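{- Let $T$ be a tree with $n$ vertices and let the evolver be adversarial (each evolver step swaps the labels at the endpoints of an arbitrarily chosen edge). Run Algorithm 1 with any speedup factor $c>2$ from an arbitrary initial hypothesis. Then there exists $z$ (a function of $n$) such that for all $j>z$, $D(\mathcal{T},\mathcal{H})_j\in O(n)$.
   Context: Setting: $T=(V,E)$ is a fixed tree with $n$ vertices; labels $L=\{l_1,\dots,l_n\}$ are placed by a bijection $M_T:L\to V$, which an evolver changes by swapping the labels across an edge of $T$. The algorithm keeps a map $M_H:L\to V$ (not necessarily injective). An oracle $\mathcal{O}(l,u)$ returns null if $M_T(l)=u$ and otherwise the edge $(u,v)$ incident to $u$ on the tree path from $u$ to $M_T(l)$. Algorithm 1 repeats forever an iteration: for $i=1,\dots,n$, while $\mathcal{O}(l_i,M_H(l_i))\neq$ null, set $(u,v)\gets\mathcal{O}(l_i,M_H(l_i))$ and $M_H(l_i)\gets v$. With speedup $c$, the algorithm performs one oracle query per time unit and the evolver one swap every $c$ time units. The distance is $D(\mathcal{T},\mathcal{H})=\sum_{l\in L} d_T(M_T(l),M_H(l))$ with $d_T$ the tree path length, and $D(\mathcal{T},\mathcal{H})_j$ denotes its value at the start of the $j$-th iteration.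
   Formalization: The speedup factor c ranges only over rational numbers greater than 2, with the evolver's swap count after t time units computed as the integer part of t/c. -}

module Defs where

open import Data.Nat using (ℕ; zero; suc; _+_; _*_; _∸_; _<_; _≤_; _<ᵇ_; NonZero)
open import Data.Nat.DivMod using (_/_)
open import Data.Bool using (Bool; true; false; _∧_; _∨_; if_then_else_)
open import Data.Fin using (Fin; zero; suc; inject₁; fromℕ; _≟_)
open import Data.Maybe using (Maybe; just; nothing)
import Data.Maybe as Maybe
open import Data.List using (List; []; _∷_; allFin; map)
open import Data.Nat.ListAction using (sum)
open import Data.Bool.ListAction using (any)
open import Data.Product using (_×_; _,_; proj₁; proj₂; Σ)
open import Relation.Nullary.Decidable using (⌊_⌋)
open import Relation.Binary.PropositionalEquality using (_≡_)
open import Function.Definitions using (Injective)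
import Data.Empty

Graph : ℕ → Set
Graph n = Fin n → Fin n → Bool

_==_ : ∀ {n} → Fin n → Fin n → Bool
u == v = ⌊ u ≟ v ⌋

reach : ∀ {n} → Graph n → ℕ → Fin n → Fin n → Bool
reach {n} G zero    u v = u == v
reach {n} G (suc k) u v = reach G k u v ∨ any (λ w → reach G k u w ∧ G w v) (allFin n)

-- Tree-path distance d_T(u,v): the least k with a walk of length k from u to v
-- (searched among k = 0 … n; in a connected graph on n vertices it is ≤ n-1).
distSearch : ∀ {n} → Graph n → Fin n → Fin n → ℕ → ℕ → ℕ
distSearch G u v k zero    = k
distSearch G u v k (suc f) = if reach G k u v then k else distSearch G u v (suc k) f

dist : ∀ {n} → Graph n → Fin n → Fin n → ℕ
dist {n} G u v = distSearch G u v 0 n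

record Cycle {n} (G : Graph n) : Set where
  field
    len    : ℕ
    vtx    : Fin (suc (suc (suc len))) → Fin n
    simple : Injective _≡_ _≡_ vtx
    step   : ∀ (i : Fin (suc (suc len))) → G (vtx (inject₁ i)) (vtx (suc i)) ≡ true
    close  : G (vtx (fromℕ (suc (suc len)))) (vtx zero) ≡ true

record IsTree {n} (G : Graph n) : Set where
  field
    symmetric : ∀ u v → G u v ≡ G v u
    loopless  : ∀ u → G u u ≡ false
    connected : ∀ u v → reach G n u v ≡ true
    acyclic   : Cycle G → Data.Empty.⊥

-- Label placements.  Labels are L = Fin n (label l_i is i), vertices are Fin n.

Placement : ℕ → Set
Placement n = Fin n → Fin n

firstSuch : ∀ {n} → (Fin n → Bool) → List (Fin n) → Maybe (Fin n)
firstSuch P []       = nothing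
firstSuch P (x ∷ xs) = if P x then just x else firstSuch P xs

-- Oracle O(l,u): nothing (= null) if M_T(l) = u; otherwise just v, where (u,v) is
-- the edge incident to u on the tree path from u to M_T(l), i.e. the neighbour v
-- of u that is strictly closer to M_T(l).
oracle : ∀ {n} → Graph n → Placement n → Fin n → Fin n → Maybe (Fin n)
oracle {n} G MT l u with u == MT l
... | true  = nothing
... | false = firstSuch (λ v → G u v ∧ (dist G v (MT l) <ᵇ dist G u (MT l))) (allFin n)

swapAt : ∀ {n} → Fin n → Fin n → Placement n → Placement n
swapAt a b MT l = if MT l == a then b else (if MT l == b then a else MT l)

D : ∀ {n} → Graph n → Placement n → Placement n → ℕ
D {n} G MT MH = sum (map (λ l → dist G (MT l) (MH l)) (allFin n))

setAt : ∀ {n} → Placement n → Fin n → Fin n → Placement n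
setAt MH l v l' = if l' == l then v else MH l'

advance : ∀ {m} → Fin (suc m) → Maybe (Fin (suc m))
advance {zero}  zero    = nothing
advance {suc m} zero    = just (suc zero)
advance {suc m} (suc i) = Maybe.map suc (advance {m} i)

record State (n : ℕ) : Set where
  constructor st
  field
    MT   : Placement n
    MH   : Placement n
    idx  : Fin n
    iter : ℕ             -- number of completed iterations (0-based iteration counter)
open State public

Adversary : ℕ → Set
Adversary n = ℕ → Fin n × Fin n

algStep : ∀ {m} → Graph (suc m) → State (suc m) → State (suc m)
algStep G (st MT MH i j) with oracle G MT i (MH i)
... | just v  = st MT (setAt MH i v) i j
... | nothing with advance i
...   | just i' = st MT MH i' j
...   | nothing = st MT MH zero (suc j)

applySwaps : ∀ {n} → Adversary n → ℕ → ℕ → Placement n → Placement n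
applySwaps adv k zero    MT = MT
applySwaps adv k (suc r) MT = applySwaps adv (suc k) r (swapAt (proj₁ (adv k)) (proj₂ (adv k)) MT)

-- Number of evolver swaps performed during the first t time units: ⌊t / c⌋ = ⌊t q / p⌋.
swapsBy : (p q : ℕ) → .{{NonZero p}} → ℕ → ℕ
swapsBy p q t = (t * q) / p

-- run t = state at time t (before the query of time unit t).  During time unit t the
-- algorithm performs one query, then the evolver performs the swaps that fall due
-- (⌊(t+1)/c⌋ - ⌊t/c⌋ of them; at most one since c > 2).
run : ∀ {m} (p q : ℕ) → .{{NonZero p}} → Graph (suc m) → Adversary (suc m)
      → Placement (suc m) → Placement (suc m) → ℕ → State (suc m)
run p q G adv MT0 MH0 zero    = st MT0 MH0 zero 0
run p q G adv MT0 MH0 (suc t) =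
  let s  = algStep G (run p q G adv MT0 MH0 t)
      k  = swapsBy p q t
      k' = swapsBy p q (suc t)
  in st (applySwaps adv k (k' ∸ k) (MT s)) (MH s) (idx s) (iter s)

IterStartsAt : ∀ {m} (p q : ℕ) → .{{NonZero p}} → Graph (suc m) → Adversary (suc m)
      → Placement (suc m) → Placement (suc m) → ℕ → ℕ → Set
IterStartsAt p q G adv MT0 MH0 j t =
  iter (run p q G adv MT0 MH0 t) ≡ j × (∀ t' → t' < t → iter (run p q G adv MT0 MH0 t') < j)

-- Within an iteration of Algorithm 1 every oracle query either moves one hypothesis a step closer
-- to its label (the distance D drops by one) or finishes the current label, whose distance is then
-- 0, while every evolver swap raises D by at most 2.  With speedup c = p/q > 2 the evolver makes
-- S ≤ L/c + 1 swaps during L queries, so an iteration started with distance D₀ ends after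
-- L ≤ D₀ + n + 2S queries, which is O(D₀ + n).  At its end D₁ is at most 2S, the damage done to
-- the labels already finished; combining this with D₁ + L ≤ D₀ + n + 2S and S ≤ L/c + 1 gives
-- (2q+1) D₁ ≤ 2q (D₀ + n) + 2p.  So each iteration either ends with D ≤ 2qn + 2p or strictly
-- decreases D, and since D ≤ n² initially, from iteration n² on D ≤ (2q + 2p) n.

module Submission where

open import Defs
open import Data.Bool using (Bool; true; false; T; _∧_; if_then_else_)
open import Data.Bool.Properties using (T-≡; T-∧; T-∨)
open import Data.Empty using (⊥-elim)
open import Data.Fin using (Fin; zero; suc; toℕ; _≟_)
open import Data.Fin.Properties using (toℕ-injective; toℕ≤pred[n])
open import Data.List using ([]; _∷_; allFin; map; length)
open import Data.List.Membership.Propositional using (_∈_; lose)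
open import Data.List.Membership.Propositional.Properties using (∈-allFin)
open import Data.List.Properties using (length-tabulate)
open import Data.List.Relation.Unary.All using (All)
import Data.List.Relation.Unary.All as All
import Data.List.Relation.Unary.AllPairs as AllPairs
open import Data.List.Relation.Unary.Any using (here; there; satisfied)
open import Data.List.Relation.Unary.Any.Properties using (any⁺; any⁻)
open import Data.List.Relation.Unary.Unique.Propositional using (Unique)
open import Data.List.Relation.Unary.Unique.Propositional.Properties using (allFin⁺)
open import Data.Maybe using (just; nothing)
open import Data.Nat using (ℕ; zero; suc; _+_; _*_; _∸_; _<_; _≤_; _<ᵇ_; pred; NonZero; z≤n; s≤s; s≤s⁻¹)
open import Data.Nat.DivMod using (_/_; _%_; m/n*n≤m; m≡m%n+[m/n]*n; m%n<n; /-monoˡ-≤)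
open import Data.Nat.ListAction using (sum)
open import Data.Nat.Properties hiding (_≟_)
open import Data.Nat.Tactic.RingSolver using (solve)
open import Data.Product using (Σ; ∃; _×_; _,_; proj₁; proj₂)
open import Data.Sum using (_⊎_; inj₁; inj₂)
open import Function using (id; Equivalence)
open import Function.Definitions using (Injective)
open import Relation.Binary.PropositionalEquality
open import Relation.Nullary using (¬_; Dec; yes; no)
open import Relation.Nullary.Decidable using (toWitness; fromWitness)
open import Algebra.Properties.CommutativeSemigroup +-commutativeSemigroup
  using () renaming (interchange to +-interchange)

open Equivalence using (to; from)

module _ {A : Set} where

  sum-map-mono : ∀ {f g : A → ℕ} xs → (∀ x → f x ≤ g x) → sum (map f xs) ≤ sum (map g xs)
  sum-map-mono []       f≤g = z≤n
  sum-map-mono (x ∷ xs) f≤g = +-mono-≤ (f≤g x) (sum-map-mono xs f≤g)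

  sum-map-mono-< : ∀ {f g : A → ℕ} {y} xs → (∀ x → f x ≤ g x) → y ∈ xs → f y < g y →
                   sum (map f xs) < sum (map g xs)
  sum-map-mono-< (x ∷ xs) f≤g (here refl) fy<gy = +-mono-<-≤ fy<gy (sum-map-mono xs f≤g)
  sum-map-mono-< (x ∷ xs) f≤g (there y∈xs) fy<gy = +-mono-≤-< (f≤g x) (sum-map-mono-< xs f≤g y∈xs fy<gy)

  sum-map-+ : ∀ (f g : A → ℕ) xs → sum (map (λ x → f x + g x) xs) ≡ sum (map f xs) + sum (map g xs)
  sum-map-+ f g []       = refl
  sum-map-+ f g (x ∷ xs) = begin
    f x + g x + sum (map (λ x → f x + g x) xs)    ≡⟨ cong (f x + g x +_) (sum-map-+ f g xs) ⟩
    f x + g x + (sum (map f xs) + sum (map g xs)) ≡⟨ +-interchange (f x) (g x) _ _ ⟩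
    f x + sum (map f xs) + (g x + sum (map g xs)) ∎
    where open ≡-Reasoning

  sum-map-≤-+ : ∀ {f g h : A → ℕ} xs → (∀ x → f x ≤ g x + h x) →
                sum (map f xs) ≤ sum (map g xs) + sum (map h xs)
  sum-map-≤-+ {g = g} {h} xs f≤g+h =
    ≤-trans (sum-map-mono xs f≤g+h) (≤-reflexive (sum-map-+ g h xs))

  sum-map-≡0 : ∀ {f : A → ℕ} {xs} → All (λ x → f x ≡ 0) xs → sum (map f xs) ≡ 0
  sum-map-≡0 All.[]            = refl
  sum-map-≡0 (fx≡0 All.∷ f≡0) = cong₂ _+_ fx≡0 (sum-map-≡0 f≡0)

  sum-map-≤-* : ∀ {f : A → ℕ} {c} xs → (∀ x → f x ≤ c) → sum (map f xs) ≤ length xs * c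
  sum-map-≤-* []       f≤c = z≤n
  sum-map-≤-* (x ∷ xs) f≤c = +-mono-≤ (f≤c x) (sum-map-≤-* xs f≤c)

sum-map-indicator-≤1 : ∀ {A : Set} {n} {F : A → Fin n} → Injective _≡_ _≡_ F →
                       ∀ a {xs} → Unique xs →
                       sum (map (λ x → if F x == a then 1 else 0) xs) ≤ 1
sum-map-indicator-≤1 F-inj a {[]} _ = z≤n
sum-map-indicator-≤1 {F = F} F-inj a {x ∷ xs} (x∉xs AllPairs.∷ xs!) with F x ≟ a
... | no  _    = sum-map-indicator-≤1 F-inj a xs!
... | yes refl = ≤-reflexive (cong suc (sum-map-≡0 (All.map miss x∉xs)))
  where
  miss : ∀ {y} → x ≢ y → (if F y == F x then 1 else 0) ≡ 0
  miss {y} x≢y with F y ≟ F x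
  ... | yes Fy≡Fx = ⊥-elim (x≢y (F-inj (sym Fy≡Fx)))
  ... | no  _     = refl

-- T (reach G k u v) as a record, so that k, u and v can be inferred from it.
record Reach {n} (G : Graph n) (k : ℕ) (u v : Fin n) : Set where
  constructor reached
  field reaches : T (reach G k u v)

module _ {n} {G : Graph n} where

  reach-refl : ∀ {u} → Reach G 0 u u
  reach-refl = reached (fromWitness refl)

  reach-zero : ∀ {u v} → Reach G 0 u v → u ≡ v
  reach-zero (reached r) = toWitness r

  reach-suc : ∀ {k u v} → Reach G k u v → Reach G (suc k) u v
  reach-suc (reached r) = reached (from T-∨ (inj₁ r))

  reach-snoc : ∀ {k u w v} → Reach G k u w → T (G w v) → Reach G (suc k) u v
  reach-snoc {w = w} (reached r) e = reached (from T-∨ (inj₂ (any⁺ _ (lose (∈-allFin w) (from T-∧ (r , e))))))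

  reach-unsnoc : ∀ {k u v} → Reach G (suc k) u v → Reach G k u v ⊎ ∃ λ w → Reach G k u w × T (G w v)
  reach-unsnoc (reached r) with to T-∨ r
  ... | inj₁ r′ = inj₁ (reached r′)
  ... | inj₂ r′ with satisfied (any⁻ _ (allFin n) r′)
  ...   | w , rw with to T-∧ rw
  ...     | r″ , e = inj₂ (w , reached r″ , e)

  reach-cons : ∀ {k u w v} → T (G u w) → Reach G k w v → Reach G (suc k) u v
  reach-cons {zero} e r with reach-zero r
  ... | refl = reach-snoc reach-refl e
  reach-cons {suc k} e r with reach-unsnoc r
  ... | inj₁ r′            = reach-suc (reach-cons e r′)
  ... | inj₂ (x , r′ , e′) = reach-snoc (reach-cons e r′) e′

  distSearch-reaches : ∀ {u v} k f → Reach G (k + f) u v → Reach G (distSearch G u v k f) u v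
  distSearch-reaches {u} {v} k zero    r = subst (λ k → Reach G k u v) (+-identityʳ k) r
  distSearch-reaches {u} {v} k (suc f) r with reach G k u v in found
  ... | true  = reached (from T-≡ found)
  ... | false = distSearch-reaches (suc k) f (subst (λ k → Reach G k u v) (+-suc k f) r)

  distSearch-least : ∀ {u v k′} k f → (∀ i → i < k → ¬ Reach G i u v) → Reach G k′ u v →
                     distSearch G u v k f ≤ k′
  distSearch-least         k zero    below r = ≮⇒≥ (λ k′<k → below _ k′<k r)
  distSearch-least {u} {v} k (suc f) below r with reach G k u v in found
  ... | true  = ≮⇒≥ (λ k′<k → below _ k′<k r)
  ... | false = distSearch-least (suc k) f below′ r
    where
    below′ : ∀ i → i < suc k → ¬ Reach G i u v
    below′ i i<1+k with m≤n⇒m<n∨m≡n (s≤s⁻¹ i<1+k)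
    ... | inj₁ i<k  = below i i<k
    ... | inj₂ refl = λ (reached ri) → subst T found ri

  distSearch≤ : ∀ u v k f → distSearch G u v k f ≤ k + f
  distSearch≤ u v k zero    = m≤m+n k 0
  distSearch≤ u v k (suc f) with reach G k u v
  ... | true  = m≤m+n k (suc f)
  ... | false = ≤-trans (distSearch≤ u v (suc k) f) (≤-reflexive (sym (+-suc k f)))

isCloserNeighbour : ∀ {n} → Graph n → Fin n → Fin n → Fin n → Bool
isCloserNeighbour G u t v = G u v ∧ (dist G v t <ᵇ dist G u t)

firstSuch-just : ∀ {n} (P : Fin n → Bool) xs {v} → firstSuch P xs ≡ just v → T (P v)
firstSuch-just P (x ∷ xs) found with P x in Px
firstSuch-just P (x ∷ xs) refl | true  = from T-≡ Px
firstSuch-just P (x ∷ xs) found | false = firstSuch-just P xs found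

firstSuch-nothing : ∀ {n} (P : Fin n → Bool) xs {x} → firstSuch P xs ≡ nothing → x ∈ xs → ¬ T (P x)
firstSuch-nothing P (y ∷ xs) none x∈ Px with P y in Py
firstSuch-nothing P (y ∷ xs) ()   x∈           Px | true
firstSuch-nothing P (y ∷ xs) none (here refl)  Px | false = subst T Py Px
firstSuch-nothing P (y ∷ xs) none (there x∈xs) Px | false = firstSuch-nothing P xs none x∈xs Px

-- swapAt a b MT is definitionally transposition a b ∘ MT.
transposition : ∀ {n} → Fin n → Fin n → Fin n → Fin n
transposition a b = swapAt a b id

transposition-left : ∀ {n} (a b : Fin n) → transposition a b a ≡ b
transposition-left a b with a ≟ a
... | yes _   = refl
... | no  a≢a = ⊥-elim (a≢a refl)

transposition-right : ∀ {n} (a b : Fin n) → transposition a b b ≡ a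
transposition-right a b with b ≟ a
... | yes refl = refl
... | no  _ with b ≟ b
...   | yes _   = refl
...   | no  b≢b = ⊥-elim (b≢b refl)

transposition-other : ∀ {n} {a b x : Fin n} → x ≢ a → x ≢ b → transposition a b x ≡ x
transposition-other {a = a} {b} {x} x≢a x≢b with x ≟ a
... | yes x≡a = ⊥-elim (x≢a x≡a)
... | no  _ with x ≟ b
...   | yes x≡b = ⊥-elim (x≢b x≡b)
...   | no  _   = refl

transposition-involutive : ∀ {n} (a b x : Fin n) → transposition a b (transposition a b x) ≡ x
transposition-involutive a b x = by-cases (x ≟ a) (x ≟ b)
  where
  by-cases : Dec (x ≡ a) → Dec (x ≡ b) → transposition a b (transposition a b x) ≡ x
  by-cases (yes refl) _ = trans (cong (transposition x b) (transposition-left x b)) (transposition-right x b)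
  by-cases (no x≢a) (yes refl) = trans (cong (transposition a x) (transposition-right a x)) (transposition-left a x)
  by-cases (no x≢a) (no x≢b) = trans (cong (transposition a b) τx≡x) τx≡x
    where
    τx≡x : transposition a b x ≡ x
    τx≡x = transposition-other x≢a x≢b

swapAt-injective : ∀ {n} (a b : Fin n) {MT} → Injective _≡_ _≡_ MT → Injective _≡_ _≡_ (swapAt a b MT)
swapAt-injective a b {MT} MT-inj {l} {l′} eq = MT-inj (begin
  MT l                                          ≡⟨ transposition-involutive a b (MT l) ⟨
  transposition a b (transposition a b (MT l))  ≡⟨ cong (transposition a b) eq ⟩
  transposition a b (transposition a b (MT l′)) ≡⟨ transposition-involutive a b (MT l′) ⟩
  MT l′                                         ∎)
  where open ≡-Reasoning

setAt-same : ∀ {n} (MH : Placement n) i v → setAt MH i v i ≡ v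
setAt-same MH i v with i ≟ i
... | yes _   = refl
... | no  i≢i = ⊥-elim (i≢i refl)

setAt-other : ∀ {n} (MH : Placement n) {i v l} → l ≢ i → setAt MH i v l ≡ MH l
setAt-other MH {i} {l = l} l≢i with l ≟ i
... | yes l≡i = ⊥-elim (l≢i l≡i)
... | no  _   = refl

maskedD : ∀ {n} → Graph n → (Fin n → Bool) → Placement n → Placement n → ℕ
maskedD {n} G w MT MH = sum (map (λ l → if w l then dist G (MT l) (MH l) else 0) (allFin n))

mask-≤-+ : ∀ c {x y h} → x ≤ y + h → (if c then x else 0) ≤ (if c then y else 0) + h
mask-≤-+ true  x≤y+h = x≤y+h
mask-≤-+ false _     = z≤n

mask-mono : ∀ c {x y} → x ≤ y → (if c then x else 0) ≤ (if c then y else 0)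
mask-mono true  x≤y = x≤y
mask-mono false _   = z≤n

module _ {n} (G : Graph n) where

  maskedD-mono : ∀ w MT {MH MH′} → (∀ l → dist G (MT l) (MH′ l) ≤ dist G (MT l) (MH l)) →
                 maskedD G w MT MH′ ≤ maskedD G w MT MH
  maskedD-mono w MT closer = sum-map-mono (allFin n) (λ l → mask-mono (w l) (closer l))

  D-mono-< : ∀ MT {MH MH′} i → (∀ l → dist G (MT l) (MH′ l) ≤ dist G (MT l) (MH l)) →
             dist G (MT i) (MH′ i) < dist G (MT i) (MH i) → D G MT MH′ < D G MT MH
  D-mono-< MT i closer closer-at-i = sum-map-mono-< (allFin n) closer (∈-allFin i) closer-at-i

  maskedD-reweight : ∀ w w′ MT MH → (∀ l → T (w′ l) → T (w l) ⊎ dist G (MT l) (MH l) ≡ 0) →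
                     maskedD G w′ MT MH ≤ maskedD G w MT MH
  maskedD-reweight w w′ MT MH covered = sum-map-mono (allFin n) pointwise
    where
    pointwise : ∀ l → (if w′ l then dist G (MT l) (MH l) else 0) ≤ (if w l then dist G (MT l) (MH l) else 0)
    pointwise l with w′ l in w′l
    ... | false = z≤n
    ... | true with covered l (from T-≡ w′l)
    ...   | inj₂ d≡0 rewrite d≡0 = z≤n
    ...   | inj₁ wl with w l
    ...     | true  = ≤-refl
    ...     | false = ⊥-elim wl

D≤n*n : ∀ {n} (G : Graph n) MT MH → D G MT MH ≤ n * n
D≤n*n {n} G MT MH = ≤-trans (sum-map-≤-* (allFin n) (λ l → distSearch≤ {G = G} (MT l) (MH l) 0 n))
                            (≤-reflexive (cong (_* n) (length-tabulate {n = n} id)))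

module Connected {n} {G : Graph n} (G-sym : ∀ u v → G u v ≡ G v u)
                 (G-connected : ∀ u v → reach G n u v ≡ true) where

  edge-sym : ∀ {u v} → T (G u v) → T (G v u)
  edge-sym {u} {v} = subst T (G-sym u v)

  reach-sym : ∀ {k u v} → Reach G k u v → Reach G k v u
  reach-sym {zero} r with reach-zero r
  ... | refl = r
  reach-sym {suc k} r with reach-unsnoc r
  ... | inj₁ r′            = reach-suc (reach-sym r′)
  ... | inj₂ (w , r′ , e) = reach-cons (edge-sym e) (reach-sym r′)

  dist-reaches : ∀ u v → Reach G (dist G u v) u v
  dist-reaches u v = distSearch-reaches 0 n (reached (from T-≡ (G-connected u v)))

  dist-least : ∀ {k u v} → Reach G k u v → dist G u v ≤ k
  dist-least = distSearch-least 0 n (λ _ ())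

  dist-sym : ∀ u v → dist G u v ≡ dist G v u
  dist-sym u v = ≤-antisym (dist-least (reach-sym (dist-reaches v u)))
                           (dist-least (reach-sym (dist-reaches u v)))

  dist-refl : ∀ u → dist G u u ≡ 0
  dist-refl u = n≤0⇒n≡0 (dist-least reach-refl)

  dist-edge : ∀ {a b} y → T (G a b) → dist G b y ≤ suc (dist G a y)
  dist-edge y e = dist-least (reach-cons (edge-sym e) (dist-reaches _ y))

  closer-neighbour : ∀ {u t} → u ≢ t → ∃ λ v → T (G u v) × dist G v t < dist G u t
  closer-neighbour {u} {t} u≢t with dist G u t in d≡ | dist-reaches u t
  ... | zero  | r = ⊥-elim (u≢t (reach-zero r))
  ... | suc d | r with reach-unsnoc (reach-sym r)
  ...   | inj₁ r′ = ⊥-elim (1+n≰n (begin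
          suc d        ≡⟨ d≡ ⟨
          dist G u t   ≡⟨ dist-sym u t ⟩
          dist G t u   ≤⟨ dist-least r′ ⟩
          d            ∎))
    where open ≤-Reasoning
  ...   | inj₂ (w , r′ , e) = w , edge-sym e , s≤s (≤-trans (≤-reflexive (dist-sym w t)) (dist-least r′))

  dist-transposition : ∀ {a b} → T (G a b) → ∀ x y →
    dist G (transposition a b x) y ≤ dist G x y + ((if x == a then 1 else 0) + (if x == b then 1 else 0))
  dist-transposition {a} {b} e x y with x ≟ a
  ... | yes refl = ≤-trans (dist-edge y e) (≤-trans (≤-reflexive (+-comm 1 _)) (+-monoʳ-≤ _ (m≤m+n 1 _)))
  ... | no  _ with x ≟ b
  ...   | yes refl = ≤-trans (dist-edge y (edge-sym e)) (≤-reflexive (+-comm 1 _))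
  ...   | no  _    = m≤m+n _ 0

  maskedD-swapAt : ∀ {a b} w MT MH → T (G a b) → Injective _≡_ _≡_ MT →
                   maskedD G w (swapAt a b MT) MH ≤ maskedD G w MT MH + 2
  maskedD-swapAt {a} {b} w MT MH e MT-inj = begin
    maskedD G w (swapAt a b MT) MH
      ≤⟨ sum-map-≤-+ (allFin n) (λ l → mask-≤-+ (w l) (dist-transposition e (MT l) (MH l))) ⟩
    maskedD G w MT MH + sum (map (λ l → hits a l + hits b l) (allFin n))
      ≡⟨ cong (maskedD G w MT MH +_) (sum-map-+ (hits a) (hits b) (allFin n)) ⟩
    maskedD G w MT MH + (sum (map (hits a) (allFin n)) + sum (map (hits b) (allFin n)))
      ≤⟨ +-monoʳ-≤ _ (+-mono-≤ (sum-map-indicator-≤1 MT-inj a (allFin⁺ n))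
                                (sum-map-indicator-≤1 MT-inj b (allFin⁺ n))) ⟩
    maskedD G w MT MH + 2 ∎
    where
    open ≤-Reasoning
    hits : Fin n → Fin n → ℕ
    hits x l = if MT l == x then 1 else 0

  applySwaps-injective : ∀ (adv : Adversary n) k r {MT : Placement n} →
                         Injective _≡_ _≡_ MT → Injective _≡_ _≡_ (applySwaps adv k r MT)
  applySwaps-injective adv k zero    MT-inj = MT-inj
  applySwaps-injective adv k (suc r) MT-inj = applySwaps-injective adv (suc k) r (swapAt-injective _ _ MT-inj)

  maskedD-applySwaps : ∀ {adv} → (∀ k → G (proj₁ (adv k)) (proj₂ (adv k)) ≡ true) →
                       ∀ w k r MT MH → Injective _≡_ _≡_ MT →
                       maskedD G w (applySwaps adv k r MT) MH ≤ maskedD G w MT MH + 2 * r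
  maskedD-applySwaps         edges w k zero    MT MH MT-inj = m≤m+n _ 0
  maskedD-applySwaps {adv} edges w k (suc r) MT MH MT-inj = begin
    maskedD G w (applySwaps adv (suc k) r (swapAt a b MT)) MH
      ≤⟨ maskedD-applySwaps edges w (suc k) r _ MH (swapAt-injective a b MT-inj) ⟩
    maskedD G w (swapAt a b MT) MH + 2 * r
      ≤⟨ +-monoˡ-≤ (2 * r) (maskedD-swapAt w MT MH (from T-≡ (edges k)) MT-inj) ⟩
    maskedD G w MT MH + 2 + 2 * r
      ≡⟨ trans (+-assoc _ 2 (2 * r)) (cong (maskedD G w MT MH +_) (sym (*-suc 2 r))) ⟩
    maskedD G w MT MH + 2 * suc r ∎
    where
    open ≤-Reasoning
    a b : Fin n
    a = proj₁ (adv k)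
    b = proj₂ (adv k)

  setAt-closer : ∀ (MT MH : Placement n) i v → dist G v (MT i) < dist G (MH i) (MT i) →
                 dist G (MT i) (setAt MH i v i) < dist G (MT i) (MH i)
  setAt-closer MT MH i v closer = begin-strict
    dist G (MT i) (setAt MH i v i) ≡⟨ cong (dist G (MT i)) (setAt-same MH i v) ⟩
    dist G (MT i) v                ≡⟨ dist-sym (MT i) v ⟩
    dist G v (MT i)                <⟨ closer ⟩
    dist G (MH i) (MT i)           ≡⟨ dist-sym (MH i) (MT i) ⟩
    dist G (MT i) (MH i)           ∎
    where open ≤-Reasoning

  setAt-no-farther : ∀ (MT MH : Placement n) i v → dist G v (MT i) < dist G (MH i) (MT i) →
                     ∀ l → dist G (MT l) (setAt MH i v l) ≤ dist G (MT l) (MH l)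
  setAt-no-farther MT MH i v closer l = by-cases (l ≟ i)
    where
    by-cases : Dec (l ≡ i) → dist G (MT l) (setAt MH i v l) ≤ dist G (MT l) (MH l)
    by-cases (yes refl) = <⇒≤ (setAt-closer MT MH l v closer)
    by-cases (no l≢i)   = ≤-reflexive (cong (dist G (MT l)) (setAt-other MH l≢i))

advance-just : ∀ {m} (i : Fin (suc m)) {i′} → advance i ≡ just i′ → toℕ i′ ≡ suc (toℕ i)
advance-just {suc m} zero    refl = refl
advance-just {suc m} (suc i) next with advance i in next′
advance-just {suc m} (suc i) refl | just _ = cong suc (advance-just i next′)

advance-nothing : ∀ {m} (i : Fin (suc m)) → advance i ≡ nothing → toℕ i ≡ m
advance-nothing {zero}  zero    refl = refl
advance-nothing {suc m} (suc i) last with advance i in last′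
advance-nothing {suc m} (suc i) refl | nothing = cong suc (advance-nothing i last′)

-- The case splits below mirror the definition of oracle, so that algStep reduces in each branch.
algStep-MT : ∀ {m} (G : Graph (suc m)) s → MT (algStep G s) ≡ MT s
algStep-MT G (st mt mh i j) with mh i ≟ mt i
... | yes _ with advance i
...   | just _  = refl
...   | nothing = refl
algStep-MT {m} G (st mt mh i j) | no _
  with firstSuch (isCloserNeighbour G (mh i) (mt i)) (allFin (suc m))
... | just _ = refl
... | nothing with advance i
...   | just _  = refl
...   | nothing = refl

module AlgorithmStep {m} {G : Graph (suc m)} (G-sym : ∀ u v → G u v ≡ G v u)
                     (G-connected : ∀ u v → reach G (suc m) u v ≡ true) where
  open Connected G-sym G-connected

  distance : State (suc m) → ℕ
  distance s = D G (MT s) (MH s)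

  before : Fin (suc m) → Fin (suc m) → Bool
  before i l = toℕ l <ᵇ toℕ i

  settled : State (suc m) → ℕ
  settled s = maskedD G (before (idx s)) (MT s) (MH s)

  data Outcome (s s′ : State (suc m)) : Set where
    continues : iter s′ ≡ iter s → suc (distance s′) + toℕ (idx s) ≤ distance s + toℕ (idx s′) →
                settled s′ ≤ settled s → Outcome s s′
    completes : iter s′ ≡ suc (iter s) → idx s′ ≡ zero → toℕ (idx s) ≡ m →
                distance s′ ≡ distance s → distance s′ ≤ settled s → Outcome s s′

  settled-start : ∀ s → idx s ≡ zero → settled s ≤ 0
  settled-start (st _ _ _ _) refl =
    ≤-trans (sum-map-≤-* {c = 0} (allFin (suc m)) (λ _ → z≤n))
            (≤-reflexive (*-zeroʳ (length (allFin (suc m)))))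

  settled-or-arrived : ∀ (mt mh : Placement (suc m)) i → mh i ≡ mt i → ∀ l → toℕ l ≤ toℕ i →
                       T (before i l) ⊎ dist G (mt l) (mh l) ≡ 0
  settled-or-arrived mt mh i arrived l l≤i with m≤n⇒m<n∨m≡n l≤i
  ... | inj₁ l<i = inj₁ (<⇒<ᵇ l<i)
  ... | inj₂ l≡i with toℕ-injective l≡i
  ...   | refl = inj₂ (trans (cong (dist G (mt l)) arrived) (dist-refl (mt l)))

  outcome : ∀ s → Outcome s (algStep G s)
  outcome (st mt mh i j) with mh i ≟ mt i
  ... | yes arrived with advance i in next
  ...   | just i′ = continues refl
          (≤-reflexive (trans (sym (+-suc _ (toℕ i)))
                              (cong (distance (st mt mh i j) +_) (sym (advance-just i next)))))
          (maskedD-reweight G (before i) (before i′) mt mh (λ l l<i′ → settled-or-arrived mt mh i arrived l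
             (s≤s⁻¹ (subst (toℕ l <_) (advance-just i next) (<ᵇ⇒< _ _ l<i′)))))
  ...   | nothing = completes refl refl (advance-nothing i next) refl
          (maskedD-reweight G (before i) (λ _ → true) mt mh (λ l _ → settled-or-arrived mt mh i arrived l
             (subst (toℕ l ≤_) (sym (advance-nothing i next)) (toℕ≤pred[n] l))))
  outcome (st mt mh i j) | no away with firstSuch (isCloserNeighbour G (mh i) (mt i)) (allFin (suc m)) in found
  ... | just v = continues refl
          (+-monoˡ-≤ (toℕ i) (D-mono-< G mt i (setAt-no-farther mt mh i v closer)
                                              (setAt-closer mt mh i v closer)))
          (maskedD-mono G (before i) mt (setAt-no-farther mt mh i v closer))
    where
    closer : dist G v (mt i) < dist G (mh i) (mt i)
    closer = <ᵇ⇒< _ _ (proj₂ (to T-∧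
               (firstSuch-just (isCloserNeighbour G (mh i) (mt i)) (allFin (suc m)) found)))
  ... | nothing with closer-neighbour away
  ...   | v , edge , closer = ⊥-elim (firstSuch-nothing (isCloserNeighbour G (mh i) (mt i)) (allFin (suc m))
                                                        found (∈-allFin v) (from T-∧ (edge , <⇒<ᵇ closer)))

[m+n]/o≡m/o+k⇒o*k<o+n : ∀ m n o .{{_ : NonZero o}} {k} → (m + n) / o ≡ m / o + k → o * k < o + n
[m+n]/o≡m/o+k⇒o*k<o+n m n o {k} eq = +-cancelˡ-< (m / o * o) (o * k) (o + n) (begin-strict
  m / o * o + o * k   ≡⟨ cong (m / o * o +_) (*-comm o k) ⟩
  m / o * o + k * o   ≡⟨ *-distribʳ-+ o (m / o) k ⟨
  (m / o + k) * o     ≡⟨ cong (_* o) eq ⟨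
  (m + n) / o * o     ≤⟨ m/n*n≤m (m + n) o ⟩
  m + n               ≡⟨ cong (_+ n) (m≡m%n+[m/n]*n m o) ⟩
  m % o + m / o * o + n <⟨ +-monoˡ-< n (+-monoˡ-< (m / o * o) (m%n<n m o)) ⟩
  o + m / o * o + n   ≡⟨ cong (_+ n) (+-comm o (m / o * o)) ⟩
  m / o * o + o + n   ≡⟨ +-assoc (m / o * o) o n ⟩
  m / o * o + (o + n) ∎)
  where open ≤-Reasoning

-- If an iteration has made L steps, each lowering the distance or advancing the label index, while
-- the evolver made S ≤ L q / p + 1 swaps, then L ≤ X + 2 S forces L below p (X + 2).
iteration-length< : ∀ {p q L S} X → 2 * q < p → p * S < p + L * q → L ≤ X + 2 * S → L < p * (X + 2)
iteration-length< {p} {q} {L} {S} X 2q<p few-swaps L≤ =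
  <-≤-trans (n<1+n L) (+-cancelʳ-≤ (2 * (L * q)) (suc L) (p * (X + 2)) (≤-trans (n≤1+n _) (begin
    2 + L + 2 * (L * q)       ≡⟨ solve (L ∷ q ∷ []) ⟩
    suc (2 * q) * L + 2       ≤⟨ +-monoˡ-≤ 2 (*-monoˡ-≤ L 2q<p) ⟩
    p * L + 2                 ≤⟨ +-monoˡ-≤ 2 (*-monoʳ-≤ p L≤) ⟩
    p * (X + 2 * S) + 2       ≡⟨ solve (p ∷ X ∷ S ∷ []) ⟩
    p * X + 2 * suc (p * S)   ≤⟨ +-monoʳ-≤ (p * X) (*-monoʳ-≤ 2 few-swaps) ⟩
    p * X + 2 * (p + L * q)   ≡⟨ solve (p ∷ X ∷ L ∷ q ∷ []) ⟩
    p * (X + 2) + 2 * (L * q) ∎)))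
  where open ≤-Reasoning

iteration-contracts : ∀ {p q L S x} Y → 2 * q < p → p * S < p + L * q → x + L ≤ Y + 2 * S → x ≤ 2 * S →
                      suc (2 * q) * x ≤ 2 * q * Y + 2 * p
iteration-contracts {p} {q} {L} {S} {x} Y 2q<p few-swaps x+L≤ x≤ = begin
  suc (2 * q) * x     ≡⟨ solve (q ∷ x ∷ []) ⟩
  2 * (q * x) + x     ≤⟨ +-monoʳ-≤ (2 * (q * x)) x≤ ⟩
  2 * (q * x) + 2 * S ≡⟨ *-distribˡ-+ 2 (q * x) S ⟨
  2 * (q * x + S)     ≤⟨ *-monoʳ-≤ 2 qx+S≤ ⟩
  2 * (q * Y + p)     ≡⟨ solve (q ∷ Y ∷ p ∷ []) ⟩
  2 * q * Y + 2 * p   ∎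
  where
  open ≤-Reasoning
  qx+S≤ : q * x + S ≤ q * Y + p
  qx+S≤ = +-cancelʳ-≤ (2 * q * S) (q * x + S) (q * Y + p) (begin
    q * x + S + 2 * q * S   ≡⟨ solve (q ∷ x ∷ S ∷ []) ⟩
    q * x + suc (2 * q) * S ≤⟨ +-monoʳ-≤ (q * x) (*-monoˡ-≤ S 2q<p) ⟩
    q * x + p * S           ≤⟨ +-monoʳ-≤ (q * x) (<⇒≤ few-swaps) ⟩
    q * x + (p + L * q)     ≡⟨ solve (q ∷ x ∷ p ∷ L ∷ []) ⟩
    q * (x + L) + p         ≤⟨ +-monoˡ-≤ p (*-monoʳ-≤ q x+L≤) ⟩
    q * (Y + 2 * S) + p     ≡⟨ solve (q ∷ Y ∷ S ∷ p ∷ []) ⟩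
    q * Y + p + 2 * q * S   ∎)

contraction-step : ∀ c {x y b e} → suc c * x ≤ c * y + b → y ≤ b + e → x ≤ b + pred e
contraction-step c {x} {y} {b} {e} contracts y≤b+e with y ≤? b
... | yes y≤b = ≤-trans (*-cancelˡ-≤ (suc c) (begin
      suc c * x ≤⟨ contracts ⟩
      c * y + b ≤⟨ +-monoˡ-≤ b (*-monoʳ-≤ c y≤b) ⟩
      c * b + b ≡⟨ +-comm (c * b) b ⟩
      suc c * b ∎)) (m≤m+n b (pred e))
  where open ≤-Reasoning
... | no  y≰b = <-≤-+-pred y≤b+e (*-cancelˡ-< (suc c) x y (begin-strict
      suc c * x ≤⟨ contracts ⟩
      c * y + b <⟨ +-monoʳ-< (c * y) (≰⇒> y≰b) ⟩
      c * y + y ≡⟨ +-comm (c * y) y ⟩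
      suc c * y ∎))
  where
  open ≤-Reasoning
  <-≤-+-pred : ∀ {e} → y ≤ b + e → x < y → x ≤ b + pred e
  <-≤-+-pred {zero}   y≤b   x<y = <⇒≤ (<-≤-trans x<y y≤b)
  <-≤-+-pred {suc e′} y≤b+e x<y = s≤s⁻¹ (<-≤-trans x<y (≤-trans y≤b+e (≤-reflexive (+-suc b e′))))

progress-step : ∀ {x a d i i′ L} D₀ S r →
                x ≤ a + 2 * r → suc a + i ≤ d + i′ → d + L ≤ D₀ + i + 2 * S →
                x + suc L ≤ D₀ + i′ + 2 * (S + r)
progress-step {x} {a} {d} {i} {i′} {L} D₀ S r x≤ step progress =
  +-cancelʳ-≤ i (x + suc L) (D₀ + i′ + 2 * (S + r)) (begin
    x + suc L + i                 ≤⟨ +-monoˡ-≤ i (+-monoˡ-≤ (suc L) x≤) ⟩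
    a + 2 * r + suc L + i         ≡⟨ solve (a ∷ r ∷ L ∷ i ∷ []) ⟩
    (suc a + i) + (L + 2 * r)     ≤⟨ +-monoˡ-≤ (L + 2 * r) step ⟩
    (d + i′) + (L + 2 * r)        ≡⟨ solve (d ∷ i′ ∷ L ∷ r ∷ []) ⟩
    (d + L) + (i′ + 2 * r)        ≤⟨ +-monoˡ-≤ (i′ + 2 * r) progress ⟩
    D₀ + i + 2 * S + (i′ + 2 * r) ≡⟨ solve (D₀ ∷ i ∷ S ∷ i′ ∷ r ∷ []) ⟩
    D₀ + i′ + 2 * (S + r) + i     ∎)
  where open ≤-Reasoning

settled-step : ∀ {x a c} r S → x ≤ a + 2 * r → a ≤ c → c ≤ 2 * S → x ≤ 2 * (S + r)
settled-step r S x≤ a≤c c≤2S =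
  ≤-trans x≤ (≤-trans (+-monoˡ-≤ (2 * r) (≤-trans a≤c c≤2S))
                      (≤-reflexive (sym (*-distribˡ-+ 2 S r))))

excess-vanishes : ∀ a b {n N j} .{{_ : NonZero n}} → N < j → a * n + b + (N ∸ j) ≤ (a + b) * n
excess-vanishes a b {n} {N} {j} N<j = begin
  a * n + b + (N ∸ j) ≡⟨ cong (a * n + b +_) (m≤n⇒m∸n≡0 (<⇒≤ N<j)) ⟩
  a * n + b + 0       ≡⟨ +-identityʳ _ ⟩
  a * n + b           ≤⟨ +-monoʳ-≤ (a * n) (m≤m*n b n) ⟩
  a * n + b * n       ≡⟨ *-distribʳ-+ n a b ⟨
  (a + b) * n         ∎
  where open ≤-Reasoning

module Execution (p q : ℕ) .{{_ : NonZero p}} (2q<p : 2 * q < p) {m} {G : Graph (suc m)}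
                 (G-sym : ∀ u v → G u v ≡ G v u) (G-connected : ∀ u v → reach G (suc m) u v ≡ true)
                 (adv : Adversary (suc m)) (adv-edges : ∀ k → G (proj₁ (adv k)) (proj₂ (adv k)) ≡ true)
                 (MT₀ : Placement (suc m)) (MT₀-injective : Injective _≡_ _≡_ MT₀)
                 (MH₀ : Placement (suc m)) where
  open Connected G-sym G-connected
  open AlgorithmStep G-sym G-connected

  state : ℕ → State (suc m)
  state = run p q G adv MT₀ MH₀

  swaps : ℕ → ℕ
  swaps = swapsBy p q

  swaps-during : ℕ → ℕ
  swaps-during t = swaps (suc t) ∸ swaps t

  swaps-suc : ∀ t → swaps (suc t) ≡ swaps t + swaps-during t
  swaps-suc t = sym (m+[n∸m]≡n (/-monoˡ-≤ p (*-monoˡ-≤ q (n≤1+n t))))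

  few-swaps : ∀ {t₀ L S} → swaps (L + t₀) ≡ swaps t₀ + S → p * S < p + L * q
  few-swaps {t₀} {L} eq = [m+n]/o≡m/o+k⇒o*k<o+n (t₀ * q) (L * q) p
    (trans (cong (_/ p) (trans (sym (*-distribʳ-+ q t₀ L)) (cong (_* q) (+-comm t₀ L)))) eq)

  state-injective : ∀ t → Injective _≡_ _≡_ (MT (state t))
  state-injective zero    = MT₀-injective
  state-injective (suc t) = applySwaps-injective adv (swaps t) (swaps-during t)
    (subst (Injective _≡_ _≡_) (sym (algStep-MT G (state t))) (state-injective t))

  maskedD-suc : ∀ w t → maskedD G w (MT (state (suc t))) (MH (state (suc t))) ≤
                        maskedD G w (MT (algStep G (state t))) (MH (algStep G (state t))) + 2 * swaps-during t
  maskedD-suc w t = maskedD-applySwaps adv-edges w (swaps t) (swaps-during t) _ _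
    (subst (Injective _≡_ _≡_) (sym (algStep-MT G (state t))) (state-injective t))

  -- Times are written L + t₀ rather than t₀ + L so that suc L + t₀ reduces to suc (L + t₀).
  record Running (t₀ j L S : ℕ) : Set where
    field
      swaps-so-far : swaps (L + t₀) ≡ swaps t₀ + S
      progress     : distance (state (L + t₀)) + L ≤
                     distance (state t₀) + toℕ (idx (state (L + t₀))) + 2 * S
      settled≤     : settled (state (L + t₀)) ≤ 2 * S
      in-iteration : ∀ t → t₀ ≤ t → t ≤ L + t₀ → iter (state t) ≡ j

  record Completed (t₀ j : ℕ) : Set where
    field
      L S          : ℕ
      swaps-so-far : swaps (L + t₀) ≡ swaps t₀ + S
      progress     : distance (state (L + t₀)) + L ≤ distance (state t₀) + suc m + 2 * S
      distance≤    : distance (state (L + t₀)) ≤ 2 * S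
      in-iteration : ∀ t → t₀ ≤ t → t < L + t₀ → iter (state t) ≡ j
      next         : iter (state (L + t₀)) ≡ suc j
      restarts     : idx (state (L + t₀)) ≡ zero

  running-start : ∀ {t₀ j} → idx (state t₀) ≡ zero → iter (state t₀) ≡ j → Running t₀ j 0 0
  running-start {t₀} {j} starts iter≡j = record
    { swaps-so-far = sym (+-identityʳ (swaps t₀))
    ; progress     = ≤-trans (≤-reflexive (+-identityʳ _)) (≤-trans (m≤m+n _ _) (m≤m+n _ 0))
    ; settled≤     = settled-start (state t₀) starts
    ; in-iteration = λ t t₀≤t t≤t₀ → subst (λ t → iter (state t) ≡ j) (≤-antisym t₀≤t t≤t₀) iter≡j
    }

  swaps-so-far-suc : ∀ {t₀ L S} → swaps (L + t₀) ≡ swaps t₀ + S →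
                     swaps (suc L + t₀) ≡ swaps t₀ + (S + swaps-during (L + t₀))
  swaps-so-far-suc {t₀} {L} {S} eq =
    trans (swaps-suc (L + t₀)) (trans (cong (_+ swaps-during (L + t₀)) eq) (+-assoc (swaps t₀) S _))

  in-iteration-suc : ∀ {t₀ j L} → (∀ t → t₀ ≤ t → t ≤ L + t₀ → iter (state t) ≡ j) →
                     iter (state (suc L + t₀)) ≡ j →
                     ∀ t → t₀ ≤ t → t ≤ suc L + t₀ → iter (state t) ≡ j
  in-iteration-suc earlier now t t₀≤t t≤1+L+t₀ with m≤n⇒m<n∨m≡n t≤1+L+t₀
  ... | inj₁ t<1+L+t₀ = earlier t t₀≤t (s≤s⁻¹ t<1+L+t₀)
  ... | inj₂ refl     = now

  running-step : ∀ {t₀ j L S} → Running t₀ j L S →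
                 Running t₀ j (suc L) (S + swaps-during (L + t₀)) ⊎ Completed t₀ j
  running-step {t₀} {j} {L} {S} running with outcome (state (L + t₀))
  ... | continues same-iteration advances settles = inj₁ record
    { swaps-so-far = swaps-so-far-suc {t₀} {L} swaps-so-far
    ; progress     = progress-step (distance (state t₀)) S (swaps-during (L + t₀))
                       (maskedD-suc (λ _ → true) (L + t₀)) advances progress
    ; settled≤     = settled-step (swaps-during (L + t₀)) S
                       (maskedD-suc (before (idx (algStep G (state (L + t₀))))) (L + t₀)) settles settled≤
    ; in-iteration = in-iteration-suc in-iteration
                       (trans same-iteration (in-iteration (L + t₀) (m≤n+m t₀ L) ≤-refl))
    }
    where open Running running
  ... | completes next-iteration restarts last same-distance all-settled = inj₂ record
    { L            = suc L
    ; S            = S + swaps-during (L + t₀)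
    ; swaps-so-far = swaps-so-far-suc {t₀} {L} swaps-so-far
    ; progress     = progress-step (distance (state t₀)) S (swaps-during (L + t₀))
                       (maskedD-suc (λ _ → true) (L + t₀))
                       (≤-reflexive (trans (cong (λ d → suc d + m) same-distance) (sym (+-suc _ m))))
                       (subst (λ i → distance (state (L + t₀)) + L ≤ distance (state t₀) + i + 2 * S)
                              last progress)
    ; distance≤    = settled-step (swaps-during (L + t₀)) S
                       (maskedD-suc (λ _ → true) (L + t₀)) all-settled settled≤
    ; in-iteration = λ t t₀≤t t<1+L+t₀ → in-iteration t t₀≤t (s≤s⁻¹ t<1+L+t₀)
    ; next         = trans next-iteration (cong suc (in-iteration (L + t₀) (m≤n+m t₀ L) ≤-refl))
    ; restarts     = restarts
    }
    where open Running running

  running-or-completed : ∀ t₀ {j} → idx (state t₀) ≡ zero → iter (state t₀) ≡ j →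
                         ∀ L → (∃ λ S → Running t₀ j L S) ⊎ Completed t₀ j
  running-or-completed t₀ starts iter≡j zero = inj₁ (0 , running-start starts iter≡j)
  running-or-completed t₀ starts iter≡j (suc L) with running-or-completed t₀ starts iter≡j L
  ... | inj₂ completed      = inj₂ completed
  ... | inj₁ (S , running) with running-step running
  ...   | inj₁ running′ = inj₁ (_ , running′)
  ...   | inj₂ completed = inj₂ completed

  iteration-completes : ∀ t₀ {j} → idx (state t₀) ≡ zero → iter (state t₀) ≡ j → Completed t₀ j
  iteration-completes t₀ starts iter≡j
    with running-or-completed t₀ starts iter≡j (p * (distance (state t₀) + m + 2))
  ... | inj₂ completed     = completed
  ... | inj₁ (S , running) =
    ⊥-elim (<-irrefl refl (iteration-length< (D₀ + m) 2q<p (few-swaps {t₀} {L} swaps-so-far) L≤))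
    where
    open Running running
    D₀ L : ℕ
    D₀ = distance (state t₀)
    L  = p * (D₀ + m + 2)
    L≤ : L ≤ D₀ + m + 2 * S
    L≤ = ≤-trans (m≤n+m L _)
           (≤-trans progress (+-monoˡ-≤ (2 * S) (+-monoʳ-≤ D₀ (toℕ≤pred[n] (idx (state (L + t₀)))))))

  iteration-start : ∀ j → Σ ℕ λ t → IterStartsAt p q G adv MT₀ MH₀ j t × idx (state t) ≡ zero ×
                                    distance (state t) ≤ 2 * q * suc m + 2 * p + (suc m * suc m ∸ j)
  iteration-start zero = 0 , (refl , λ _ ()) , refl , ≤-trans (D≤n*n G MT₀ MH₀) (m≤n+m _ _)
  iteration-start (suc j) with iteration-start j
  ... | t₀ , (iter≡j , earlier) , starts , D₀≤ = L + t₀ , (next , earlier′) , restarts , D≤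
    where
    open Completed (iteration-completes t₀ starts iter≡j)
    D₀ : ℕ
    D₀ = distance (state t₀)
    earlier′ : ∀ t → t < L + t₀ → iter (state t) < suc j
    earlier′ t t<L+t₀ with t <? t₀
    ... | yes t<t₀ = m<n⇒m<1+n (earlier t t<t₀)
    ... | no  t≮t₀ = ≤-reflexive (cong suc (in-iteration t (≮⇒≥ t≮t₀) t<L+t₀))
    contracts : suc (2 * q) * distance (state (L + t₀)) ≤ 2 * q * D₀ + (2 * q * suc m + 2 * p)
    contracts = begin
      suc (2 * q) * distance (state (L + t₀))
        ≤⟨ iteration-contracts (D₀ + suc m) 2q<p (few-swaps {t₀} {L} swaps-so-far) progress distance≤ ⟩
      2 * q * (D₀ + suc m) + 2 * p              ≡⟨ cong (_+ 2 * p) (*-distribˡ-+ (2 * q) D₀ (suc m)) ⟩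
      2 * q * D₀ + 2 * q * suc m + 2 * p        ≡⟨ +-assoc (2 * q * D₀) _ _ ⟩
      2 * q * D₀ + (2 * q * suc m + 2 * p)      ∎
      where open ≤-Reasoning
    D≤ : distance (state (L + t₀)) ≤ 2 * q * suc m + 2 * p + (suc m * suc m ∸ suc j)
    D≤ = ≤-trans (contraction-step (2 * q) contracts D₀≤)
                 (≤-reflexive (cong (2 * q * suc m + 2 * p +_) (pred[m∸n]≡m∸[1+n] _ j)))

theorem9 : (p q : ℕ) → .{{_ : NonZero p}} → 1 ≤ q → 2 * q < p →
    Σ ℕ λ K → Σ (ℕ → ℕ) λ z →
      ∀ (m : ℕ) (G : Graph (suc m)) → IsTree G →
      (MT0 : Placement (suc m)) → Injective _≡_ _≡_ MT0 →
      (MH0 : Placement (suc m)) →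
      (adv : Adversary (suc m)) → (∀ k → G (proj₁ (adv k)) (proj₂ (adv k)) ≡ true) →
      ∀ j → z (suc m) < j →
      Σ ℕ λ t → IterStartsAt p q G adv MT0 MH0 j t
                × D G (MT (run p q G adv MT0 MH0 t)) (MH (run p q G adv MT0 MH0 t)) ≤ K * suc m
theorem9 p q _ 2q<p = 2 * q + 2 * p , (λ n → n * n) ,
  λ m G tree MT₀ MT₀-injective MH₀ adv adv-edges j n*n<j →
    let t , starts , _ , D≤ = Execution.iteration-start p q 2q<p (IsTree.symmetric tree)
                                (IsTree.connected tree) adv adv-edges MT₀ MT₀-injective MH₀ j
    in t , starts , ≤-trans D≤ (excess-vanishes (2 * q) (2 * p) n*n<j)
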